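{- If $G$ is a daisy of order $n$, then $\gamma_t^d(G)\le (n-1)/2$. Furthermore, $\gamma_t^d(G)=(n-1)/2$ if and only if $G\in\{D(3,3),D(4,4),D(3,7)\}$.
   Context: For a graph $G$ with no isolated vertex, a set $S\subseteq V(G)$ is a disjunctive total dominating set if every vertex $v$ of $G$ either has a neighbor in $S$ or has at least two vertices of $S$ at distance exactly $2$ from $v$; $\gamma_t^d(G)$ is the minimum size of such a set. A daisy with $k\ge 2$ petals is a connected graph obtained from $k$ disjoint cycles by identifying a set of $k$ vertices, one from each cycle, into a single vertex; if the cycles have lengths $n_1,\dots,n_k$ it is denoted $D(n_1,\dots,n_k)$. -}

module Defs where

open import Data.Nat using (ℕ; zero; suc; _+_; _∸_; _≤_)
open import Data.Fin using (Fin; toℕ)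
open import Data.Fin.Subset using (Subset; _∈_; ∣_∣)
open import Data.List using (List; []; _∷_; _++_; map)
open import Data.Nat.ListAction using (sum)
open import Data.List.Membership.Propositional using () renaming (_∈_ to _∈ˡ_)
open import Data.Product using (_×_; _,_; ∃; ∃-syntax)
open import Data.Sum using (_⊎_)
open import Relation.Nullary using (¬_)
open import Relation.Binary.PropositionalEquality using (_≡_; _≢_)

Dist2 : {n : ℕ} → (Fin n → Fin n → Set) → Fin n → Fin n → Set
Dist2 {n} Adj u v = (u ≢ v) × (¬ Adj u v) × (∃[ w ] (Adj u w × Adj w v))

IsDTD : {n : ℕ} → (Fin n → Fin n → Set) → Subset n → Set
IsDTD {n} Adj S =
  (v : Fin n) →
    (∃[ u ] (u ∈ S × Adj v u))
    ⊎ (∃[ u ] ∃[ w ] (u ≢ w × u ∈ S × w ∈ S × Dist2 Adj v u × Dist2 Adj v w))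

IsGammaTD : {n : ℕ} → (Fin n → Fin n → Set) → ℕ → Set
IsGammaTD {n} Adj m =
  (∃[ S ] (IsDTD Adj S × ∣ S ∣ ≡ m)) × ((S : Subset n) → IsDTD Adj S → m ≤ ∣ S ∣)

-- Daisies D(n₁,…,n_k), given by the list [n₁,…,n_k] of cycle lengths.
-- Vertex 0 is the common (identified) vertex; petal i of length m occupies
-- the next m-1 consecutive labels o+1,…,o+m-1 and forms the cycle
-- 0 - (o+1) - (o+2) - … - (o+m-1) - 0.

pathFrom : ℕ → ℕ → List (ℕ × ℕ)
pathFrom a zero = []
pathFrom a (suc k) = (a , suc a) ∷ pathFrom (suc a) k

petalEdges : ℕ → ℕ → List (ℕ × ℕ)
petalEdges o m = (0 , suc o) ∷ (o + (m ∸ 1) , 0) ∷ pathFrom (suc o) (m ∸ 2)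

daisyEdges : ℕ → List ℕ → List (ℕ × ℕ)
daisyEdges o [] = []
daisyEdges o (m ∷ ms) = petalEdges o m ++ daisyEdges (o + (m ∸ 1)) ms

daisyOrder : List ℕ → ℕ
daisyOrder L = suc (sum (map (λ m → m ∸ 1) L))

DaisyAdj : (L : List ℕ) → Fin (daisyOrder L) → Fin (daisyOrder L) → Set
DaisyAdj L u v = ((toℕ u , toℕ v) ∈ˡ daisyEdges 0 L) ⊎ ((toℕ v , toℕ u) ∈ˡ daisyEdges 0 L)

-- Put the centre into S and, on every petal, the vertices whose distance from the centre,
-- measured through the last vertex of the petal, is ≡ 0 or 4 (mod 5); add the first vertex
-- of a petal of length 4, and the first vertex of the first petal if the centre would
-- otherwise have no neighbour in S. Along a petal this pattern leaves every vertex with a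
-- neighbour in S or with S-vertices two steps away on both sides. Counting petal by petal
-- gives 2 ∣S∣ = n + 1 − s with a slack s ≥ 2, hence γ_t^d ≤ (n − 1)/2. The slack is 2 only
-- for D(3,3), D(4,4), D(3,7), D(4,6), D(6,6) and D(7,7), and for these six daisies γ_t^d is
-- determined by exhaustive search.

module Submission where

open import Defs
open import Data.Bool using (Bool; true; false; _∨_; not; if_then_else_)
open import Data.Bool.ListAction using (any)
open import Data.Bool.Properties using (∨-zeroʳ; ∨-conicalˡ; ∨-conicalʳ; T-≡)
open import Data.Empty using (⊥-elim)
open import Data.Fin using (Fin; toℕ; fromℕ<) renaming (zero to fzero; suc to fsuc)
open import Data.Fin.Properties using (any?; all?; toℕ-fromℕ<; toℕ<n) renaming (_≟_ to _≟ᶠ_)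
open import Data.Fin.Subset using (Subset; _∈_; ∣_∣; inside)
open import Data.Fin.Subset.Properties using (_∈?_; anySubset?)
open import Data.List using (List; []; _∷_; _++_; map; length)
open import Data.List.Properties using (++-assoc; map-++)
open import Data.List.Membership.Propositional using (find) renaming (_∈_ to _∈ˡ_)
open import Data.List.Membership.Propositional.Properties using (∈-++⁺ˡ; ∈-++⁺ʳ; ∈-++⁻; ∈-∃++)
open import Data.List.Relation.Binary.Permutation.Propositional using (_↭_; ↭-refl; ↭-trans; ↭-swap)
open import Data.List.Relation.Binary.Permutation.Propositional.Properties
  using (∈-resp-↭; ↭-length; drop-∷; ↭-singleton-inv)
open import Data.List.Relation.Unary.All as All using (All; []; _∷_)
open import Data.List.Relation.Unary.All.Properties using (++⁻ˡ; ++⁻ʳ)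
open import Data.List.Relation.Unary.Any using (here; there)
open import Data.List.Relation.Unary.Any.Properties using (any⁻)
open import Data.Nat using (ℕ; zero; suc; _+_; _*_; _∸_; _≤_; _<_; _≤?_; _<?_; _≡ᵇ_; z≤n; s≤s)
import Data.Nat as ℕ
open import Data.Nat.Induction using (<-rec)
open import Data.Nat.ListAction using (sum)
open import Data.Nat.ListAction.Properties using (sum-++)
open import Data.Nat.Properties
open import Data.Nat.Tactic.RingSolver using (solve-∀)
open import Data.Product using (_×_; _,_; proj₁; proj₂; ∃-syntax)
open import Data.Product.Properties using (≡-dec)
open import Data.Sum using (_⊎_; inj₁; inj₂)
open import Data.Vec using (Vec; []; _∷_; lookup) renaming (_++_ to _++ᵥ_)
open import Data.Vec.Properties using (lookup⇒[]=)
open import Function.Bundles using (_⇔_; mk⇔; Equivalence)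
open import Relation.Nullary using (¬_; Dec; yes; no; ¬?)
open import Relation.Nullary.Decidable using (True; False; _×-dec_; _⊎-dec_; map′; toWitness; toWitnessFalse)
open import Relation.Unary using (Decidable)
open import Relation.Binary.PropositionalEquality
  using (_≡_; _≢_; refl; sym; trans; cong; cong₂; subst; subst₂; module ≡-Reasoning)
open import Data.List.Membership.DecPropositional (≡-dec ℕ._≟_ ℕ._≟_) using () renaming (_∈?_ to _∈ˡ?_)
open import Algebra.Properties.CommutativeSemigroup +-commutativeSemigroup using (x∙yz≈y∙xz)

-- Disjunctive total domination in finite graphs

module _ {n : ℕ} {Adj : Fin n → Fin n → Set} (Adj? : ∀ u v → Dec (Adj u v)) where

  Dist2? : ∀ u v → Dec (Dist2 Adj u v)
  Dist2? u v = ¬? (u ≟ᶠ v) ×-dec ¬? (Adj? u v) ×-dec any? (λ w → Adj? u w ×-dec Adj? w v)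

  IsDTD? : (S : Subset n) → Dec (IsDTD Adj S)
  IsDTD? S = all? λ v → any? (λ u → u ∈? S ×-dec Adj? v u) ⊎-dec twoAtDistance2? v
    where
    twoAtDistance2? : ∀ v → Dec (∃[ u ] ∃[ w ] (¬ u ≡ w × u ∈ S × w ∈ S × Dist2 Adj v u × Dist2 Adj v w))
    twoAtDistance2? v =
      map′ (λ { (u , w , (u≢w , u∈S , w∈S) , du , dw) → u , w , u≢w , u∈S , w∈S , du , dw })
           (λ { (u , w , u≢w , u∈S , w∈S , du , dw) → u , w , (u≢w , u∈S , w∈S) , du , dw })
           (any? λ u → any? λ w → (¬? (u ≟ᶠ w) ×-dec u ∈? S ×-dec w ∈? S) ×-dec Dist2? v u ×-dec Dist2? v w)

minimumSubset : ∀ {n} {P : Subset n → Set} → Decidable P → ∀ S → P S →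
                ∃[ T ] (P T × ∣ T ∣ ≤ ∣ S ∣ × (∀ S′ → P S′ → ∣ T ∣ ≤ ∣ S′ ∣))
minimumSubset {P = P} P? S = <-rec Goal step ∣ S ∣ S refl
  where
  Goal : ℕ → Set
  Goal k = ∀ S → ∣ S ∣ ≡ k → P S → ∃[ T ] (P T × ∣ T ∣ ≤ ∣ S ∣ × (∀ S′ → P S′ → ∣ T ∣ ≤ ∣ S′ ∣))
  step : ∀ k → (∀ {j} → j < k → Goal j) → Goal k
  step k rec S refl PS with anySubset? (λ S′ → P? S′ ×-dec ∣ S′ ∣ <? ∣ S ∣)
  ... | yes (S′ , PS′ , S′<S) with rec S′<S S′ refl PS′
  ...   | T , PT , T≤S′ , least = T , PT , ≤-trans T≤S′ (<⇒≤ S′<S) , least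
  step k rec S refl PS | no none = S , PS , ≤-refl , λ S′ PS′ → ≮⇒≥ (λ S′<S → none (S′ , PS′ , S′<S))

module _ {n : ℕ} {Adj : Fin n → Fin n → Set} where

  gammaTD-exists : (∀ u v → Dec (Adj u v)) → ∀ S → IsDTD Adj S → ∃[ m ] (IsGammaTD Adj m × m ≤ ∣ S ∣)
  gammaTD-exists Adj? S S-dtd with minimumSubset (IsDTD? Adj?) S S-dtd
  ... | T , T-dtd , T≤S , least = ∣ T ∣ , ((T , T-dtd , refl) , least) , T≤S

  gammaTD-≥ : ∀ {m k} → IsGammaTD Adj m → ¬ (∃[ S ] (∣ S ∣ < k × IsDTD Adj S)) → k ≤ m
  gammaTD-≥ ((S , S-dtd , refl) , _) none = ≮⇒≥ (λ S<k → none (S , S<k , S-dtd))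

infixl 5 _‼_

_‼_ : ∀ {k} → Vec Bool k → ℕ → Bool
[]      ‼ _     = false
(b ∷ v) ‼ zero  = b
(b ∷ v) ‼ suc i = v ‼ i

‼⇒∈ : ∀ {k} (v : Subset k) (i : Fin k) → v ‼ toℕ i ≡ true → i ∈ v
‼⇒∈ v i v‼i = lookup⇒[]= i v (trans (lookup-‼ v i) v‼i)
  where
  lookup-‼ : ∀ {k} (v : Vec Bool k) (i : Fin k) → lookup v i ≡ v ‼ toℕ i
  lookup-‼ (b ∷ v) fzero    = refl
  lookup-‼ (b ∷ v) (fsuc i) = lookup-‼ v i

‼-++ˡ : ∀ {k l} (xs : Vec Bool k) (ys : Vec Bool l) {i} → i < k → (xs ++ᵥ ys) ‼ i ≡ xs ‼ i
‼-++ˡ (x ∷ xs) ys {zero}  _         = refl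
‼-++ˡ (x ∷ xs) ys {suc i} (s≤s i<k) = ‼-++ˡ xs ys i<k

‼-++ʳ : ∀ {k l} (xs : Vec Bool k) (ys : Vec Bool l) i → (xs ++ᵥ ys) ‼ (k + i) ≡ ys ‼ i
‼-++ʳ []       ys i = refl
‼-++ʳ (x ∷ xs) ys i = ‼-++ʳ xs ys i

-- A graph on Fin n given by a relation on the labels toℕ, so that domination can be argued in ℕ.
module Labelled {n : ℕ} (R : ℕ → ℕ → Set) (S : Subset n) where

  AtDistance2 : ℕ → ℕ → Set
  AtDistance2 x y = (x ≢ y) × ¬ R x y × ∃[ z ] (z < n × R x z × R z y)

  Dominated : ℕ → Set
  Dominated x =
    (∃[ y ] (y < n × S ‼ y ≡ true × R x y))
    ⊎ (∃[ y ] ∃[ y′ ] (y ≢ y′ × y < n × y′ < n × S ‼ y ≡ true × S ‼ y′ ≡ true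
                       × AtDistance2 x y × AtDistance2 x y′))

  ‼⇒∈fromℕ< : ∀ {y} (y< : y < n) → S ‼ y ≡ true → fromℕ< y< ∈ S
  ‼⇒∈fromℕ< y< y∈ = ‼⇒∈ S (fromℕ< y<) (trans (cong (S ‼_) (toℕ-fromℕ< y<)) y∈)

  AtDistance2⇒Dist2 : ∀ v {y} (y< : y < n) → AtDistance2 (toℕ v) y →
                      Dist2 (λ u w → R (toℕ u) (toℕ w)) v (fromℕ< y<)
  AtDistance2⇒Dist2 v y< (v≢y , ¬vy , z , z< , vz , zy) =
    (λ e → v≢y (trans (cong toℕ e) (toℕ-fromℕ< y<))) ,
    (λ vy → ¬vy (subst (R (toℕ v)) (toℕ-fromℕ< y<) vy)) ,
    fromℕ< z< , subst (R (toℕ v)) (sym (toℕ-fromℕ< z<)) vz ,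
    subst₂ R (sym (toℕ-fromℕ< z<)) (sym (toℕ-fromℕ< y<)) zy

  isDTD : (∀ x → x < n → Dominated x) → IsDTD (λ u v → R (toℕ u) (toℕ v)) S
  isDTD dom v with dom (toℕ v) (toℕ<n v)
  ... | inj₁ (y , y< , y∈ , vy) =
    inj₁ (fromℕ< y< , ‼⇒∈fromℕ< y< y∈ , subst (R (toℕ v)) (sym (toℕ-fromℕ< y<)) vy)
  ... | inj₂ (y , y′ , y≢y′ , y< , y′< , y∈ , y′∈ , vy , vy′) =
    inj₂ (fromℕ< y< , fromℕ< y′<
         , (λ e → y≢y′ (trans (sym (toℕ-fromℕ< y<)) (trans (cong toℕ e) (toℕ-fromℕ< y′<))))
         , ‼⇒∈fromℕ< y< y∈ , ‼⇒∈fromℕ< y′< y′∈ , AtDistance2⇒Dist2 v y< vy , AtDistance2⇒Dist2 v y′< vy′)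

-- Daisies

interiorSize : List ℕ → ℕ
interiorSize L = sum (map (λ m → m ∸ 1) L)

Linked : List ℕ → ℕ → ℕ → Set
Linked L x y = ((x , y) ∈ˡ daisyEdges 0 L) ⊎ ((y , x) ∈ˡ daisyEdges 0 L)

Linked-sym : ∀ {L x y} → Linked L x y → Linked L y x
Linked-sym (inj₁ p) = inj₂ p
Linked-sym (inj₂ p) = inj₁ p

∈-pathFrom⁺ : ∀ a k i → i < k → (i + a , suc (i + a)) ∈ˡ pathFrom a k
∈-pathFrom⁺ a (suc k) zero    _         = here refl
∈-pathFrom⁺ a (suc k) (suc i) (s≤s i<k) =
  there (subst (λ z → (z , suc z) ∈ˡ pathFrom (suc a) k) (+-suc i a) (∈-pathFrom⁺ (suc a) k i i<k))

∈-pathFrom⁻ : ∀ a k {x y} → (x , y) ∈ˡ pathFrom a k → (y ≡ suc x) × (a ≤ x)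
∈-pathFrom⁻ a (suc k) (here refl) = refl , ≤-refl
∈-pathFrom⁻ a (suc k) (there p) with ∈-pathFrom⁻ (suc a) k p
... | y≡1+x , a<x = y≡1+x , <⇒≤ a<x

daisyEdge-shape : ∀ o L {x y} → (x , y) ∈ˡ daisyEdges o L → (x ≡ 0) ⊎ (y ≡ 0) ⊎ (y ≡ suc x)
daisyEdge-shape o (m ∷ ms) p with ∈-++⁻ (petalEdges o m) p
... | inj₂ q                   = daisyEdge-shape (o + (m ∸ 1)) ms q
... | inj₁ (here refl)         = inj₁ refl
... | inj₁ (there (here refl)) = inj₂ (inj₁ refl)
... | inj₁ (there (there q))   = inj₂ (inj₂ (proj₁ (∈-pathFrom⁻ (suc o) (m ∸ 2) q)))

CentreOrAbove : ℕ → ℕ → Set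
CentreOrAbove o x = (x ≡ 0) ⊎ (o < x)

CentreOrAbove-mono : ∀ {o o′ x} → o ≤ o′ → CentreOrAbove o′ x → CentreOrAbove o x
CentreOrAbove-mono o≤o′ (inj₁ x≡0) = inj₁ x≡0
CentreOrAbove-mono o≤o′ (inj₂ o′<x) = inj₂ (≤-<-trans o≤o′ o′<x)

daisyEdge-above : ∀ o L → All (3 ≤_) L → ∀ {x y} → (x , y) ∈ˡ daisyEdges o L →
                  CentreOrAbove o x × CentreOrAbove o y
daisyEdge-above o (m ∷ ms) (_ ∷ 3≤ms) p with ∈-++⁻ (petalEdges o m) p
... | inj₂ q with daisyEdge-above (o + (m ∸ 1)) ms 3≤ms q
...   | ax , ay = CentreOrAbove-mono (m≤m+n o _) ax , CentreOrAbove-mono (m≤m+n o _) ay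
daisyEdge-above o (m ∷ ms) (_ ∷ _) p | inj₁ (here refl) = inj₁ refl , inj₂ ≤-refl
daisyEdge-above o (m ∷ ms) (s≤s (s≤s (s≤s _)) ∷ _) p | inj₁ (there (here refl)) =
  inj₂ (m<m+n o (s≤s z≤n)) , inj₁ refl
daisyEdge-above o (m ∷ ms) (_ ∷ _) p | inj₁ (there (there q)) with ∈-pathFrom⁻ (suc o) (m ∸ 2) q
... | refl , o<x = inj₂ o<x , inj₂ (m≤n⇒m≤1+n o<x)

interiorSize-++ : ∀ A B → interiorSize (A ++ B) ≡ interiorSize A + interiorSize B
interiorSize-++ A B = trans (cong sum (map-++ _ A B)) (sum-++ (map _ A) (map _ B))

daisyEdges-++ : ∀ o A B → daisyEdges o (A ++ B) ≡ daisyEdges o A ++ daisyEdges (o + interiorSize A) B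
daisyEdges-++ o []      B = cong (λ z → daisyEdges z B) (sym (+-identityʳ o))
daisyEdges-++ o (m ∷ A) B = begin
  petalEdges o m ++ daisyEdges (o + (m ∸ 1)) (A ++ B)
    ≡⟨ cong (petalEdges o m ++_) (daisyEdges-++ (o + (m ∸ 1)) A B) ⟩
  petalEdges o m ++ (daisyEdges (o + (m ∸ 1)) A ++ daisyEdges (o + (m ∸ 1) + interiorSize A) B)
    ≡⟨ sym (++-assoc (petalEdges o m) _ _) ⟩
  daisyEdges o (m ∷ A) ++ daisyEdges (o + (m ∸ 1) + interiorSize A) B
    ≡⟨ cong (λ z → daisyEdges o (m ∷ A) ++ daisyEdges z B) (+-assoc o (m ∸ 1) (interiorSize A)) ⟩
  daisyEdges o (m ∷ A) ++ daisyEdges (o + interiorSize (m ∷ A)) B ∎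
  where open ≡-Reasoning

pathFrom-below : ∀ a k {x y} → (x , y) ∈ˡ pathFrom a k → y ≤ k + a
pathFrom-below a (suc k) (here refl) = s≤s (m≤n+m a k)
pathFrom-below a (suc k) {y = y} (there p) = subst (y ≤_) (+-suc k a) (pathFrom-below (suc a) k p)

petalEdge-below : ∀ o m → 2 ≤ m → ∀ {x y} → (x , y) ∈ˡ petalEdges o m → x ≤ o + (m ∸ 1) × y ≤ o + (m ∸ 1)
petalEdge-below o (suc zero) (s≤s ()) _
petalEdge-below o (suc (suc k)) _ (here refl) = z≤n , subst (_≤ o + suc k) (+-comm o 1) (+-monoʳ-≤ o (s≤s z≤n))
petalEdge-below o (suc (suc k)) _ (there (here refl)) = ≤-refl , z≤n
petalEdge-below o (suc (suc k)) _ {y = y} (there (there q)) with ∈-pathFrom⁻ (suc o) k q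
... | refl , _ = <⇒≤ y≤ , y≤
  where
  y≤ : y ≤ o + suc k
  y≤ = subst (y ≤_) (trans (+-suc k o) (+-comm (suc k) o)) (pathFrom-below (suc o) k q)

daisyEdge-below : ∀ o L → All (3 ≤_) L → ∀ {x y} → (x , y) ∈ˡ daisyEdges o L →
                  x ≤ o + interiorSize L × y ≤ o + interiorSize L
daisyEdge-below o (m ∷ ms) (3≤m ∷ 3≤ms) p with ∈-++⁻ (petalEdges o m) p
... | inj₂ q = map-≤ (daisyEdge-below (o + (m ∸ 1)) ms 3≤ms q)
  where
  map-≤ : ∀ {x y} → x ≤ o + (m ∸ 1) + interiorSize ms × y ≤ o + (m ∸ 1) + interiorSize ms →
          x ≤ o + interiorSize (m ∷ ms) × y ≤ o + interiorSize (m ∷ ms)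
  map-≤ {x} {y} (x≤ , y≤) = subst (x ≤_) (+-assoc o _ _) x≤ , subst (y ≤_) (+-assoc o _ _) y≤
... | inj₁ q = map-≤ (petalEdge-below o m (≤-trans (n≤1+n 2) 3≤m) q)
  where
  map-≤ : ∀ {x y} → x ≤ o + (m ∸ 1) × y ≤ o + (m ∸ 1) →
          x ≤ o + interiorSize (m ∷ ms) × y ≤ o + interiorSize (m ∷ ms)
  map-≤ (x≤ , y≤) = ≤-trans x≤ bound , ≤-trans y≤ bound
    where
    bound : o + (m ∸ 1) ≤ o + interiorSize (m ∷ ms)
    bound = +-monoʳ-≤ o (m≤m+n (m ∸ 1) (interiorSize ms))

petalEdge⇒daisyEdge : ∀ pre m post {e} → e ∈ˡ petalEdges (interiorSize pre) m →
                      e ∈ˡ daisyEdges 0 (pre ++ m ∷ post)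
petalEdge⇒daisyEdge pre m post {e} p =
  subst (e ∈ˡ_) (sym (daisyEdges-++ 0 pre (m ∷ post))) (∈-++⁺ʳ (daisyEdges 0 pre) (∈-++⁺ˡ p))

-- Edges before the petal lie below x, edges after it above x, and the petal's only edges
-- at the centre end at its first and last vertex.
interiorEdge-avoids-centre : ∀ pre m post → All (3 ≤_) (pre ++ m ∷ post) → ∀ {x} →
                             2 + interiorSize pre ≤ x → x < interiorSize pre + (m ∸ 1) →
                             ∀ {a b} → (a , b) ∈ˡ daisyEdges 0 (pre ++ m ∷ post) →
                             (a ≢ x × b ≢ x) ⊎ (a ≢ 0 × b ≢ 0)
interiorEdge-avoids-centre pre m post 3≤L {x} lo hi e
  with ∈-++⁻ (daisyEdges 0 pre) (subst (_ ∈ˡ_) (daisyEdges-++ 0 pre (m ∷ post)) e)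
... | inj₁ e-pre with daisyEdge-below 0 pre (++⁻ˡ pre 3≤L) e-pre
...   | a≤B , b≤B = inj₁ (below a≤B , below b≤B)
  where
  below : ∀ {a} → a ≤ interiorSize pre → a ≢ x
  below a≤B = <⇒≢ (≤-<-trans a≤B (≤-trans (n≤1+n _) lo))
interiorEdge-avoids-centre pre m post 3≤L {x} lo hi e | inj₂ e-rest
  with ∈-++⁻ (petalEdges (interiorSize pre) m) e-rest
... | inj₁ (here refl)         = inj₁ (<⇒≢ (≤-trans (s≤s z≤n) lo) , <⇒≢ lo)
... | inj₁ (there (here refl)) = inj₁ (>⇒≢ hi , <⇒≢ (≤-trans (s≤s z≤n) lo))
... | inj₁ (there (there q)) with ∈-pathFrom⁻ (suc (interiorSize pre)) (m ∸ 2) q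
...   | refl , B<a = inj₂ (>⇒≢ (≤-trans (s≤s z≤n) B<a) , λ ())
interiorEdge-avoids-centre pre m post 3≤L {x} lo hi e | inj₂ e-rest | inj₂ e-post
  with daisyEdge-above (interiorSize pre + (m ∸ 1)) post (All.tail (++⁻ʳ pre 3≤L)) e-post
... | ca , cb = inj₁ (above ca , above cb)
  where
  above : ∀ {a} → CentreOrAbove (interiorSize pre + (m ∸ 1)) a → a ≢ x
  above (inj₁ refl) = <⇒≢ (≤-trans (s≤s z≤n) lo)
  above (inj₂ P<a)  = >⇒≢ (<-trans hi P<a)

interior-≁-centre : ∀ pre m post → All (3 ≤_) (pre ++ m ∷ post) → ∀ {x} →
                    2 + interiorSize pre ≤ x → x < interiorSize pre + (m ∸ 1) →
                    ¬ Linked (pre ++ m ∷ post) x 0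
interior-≁-centre pre m post 3≤L lo hi (inj₁ e) with interiorEdge-avoids-centre pre m post 3≤L lo hi e
... | inj₁ (x≢x , _) = x≢x refl
... | inj₂ (_ , 0≢0) = 0≢0 refl
interior-≁-centre pre m post 3≤L lo hi (inj₂ e) with interiorEdge-avoids-centre pre m post 3≤L lo hi e
... | inj₁ (_ , x≢x) = x≢x refl
... | inj₂ (0≢0 , _) = 0≢0 refl

record PetalPosition (o : ℕ) (L : List ℕ) (x : ℕ) : Set where
  constructor petalPosition
  field
    pre  : List ℕ
    m    : ℕ
    post : List ℕ
    j    : ℕ
    L≡   : L ≡ pre ++ m ∷ post
    x≡   : x ≡ j + (o + interiorSize pre)
    1≤j  : 1 ≤ j
    j≤   : j ≤ m ∸ 1

locate : ∀ o L x → o < x → x ≤ o + interiorSize L → PetalPosition o L x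
locate o []       x o<x x≤ = ⊥-elim (<⇒≱ o<x (subst (x ≤_) (+-identityʳ o) x≤))
locate o (m ∷ ms) x o<x x≤ with x ≤? o + (m ∸ 1)
... | yes x≤end = petalPosition [] m ms (x ∸ o) refl
                    (sym (trans (cong ((x ∸ o) +_) (+-identityʳ o)) (m∸n+n≡m (<⇒≤ o<x))))
                    (m<n⇒0<n∸m o<x)
                    (≤-trans (∸-monoˡ-≤ o x≤end) (≤-reflexive (m+n∸m≡n o (m ∸ 1))))
... | no x≰end with locate (o + (m ∸ 1)) ms x (≰⇒> x≰end)
                      (subst (x ≤_) (sym (+-assoc o (m ∸ 1) (interiorSize ms))) x≤)
...   | petalPosition pre m′ post j L≡ x≡ 1≤j j≤ =
          petalPosition (m ∷ pre) m′ post j (cong (m ∷_) L≡)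
            (trans x≡ (cong (j +_) (+-assoc o (m ∸ 1) (interiorSize pre)))) 1≤j j≤

-- The petal of length r + 2 after the petals pre: its vertices are j + B for 1 ≤ j ≤ r + 1,
-- and vertices 1 and r + 1 are joined to the centre.
module Petal (pre : List ℕ) (r : ℕ) (post : List ℕ) where

  L : List ℕ
  L = pre ++ suc (suc r) ∷ post

  B : ℕ
  B = interiorSize pre

  vertex<order : ∀ {j} → j ≤ suc r → j + B < daisyOrder L
  vertex<order {j} j≤ = s≤s (begin
    j + B                          ≤⟨ +-monoˡ-≤ B j≤ ⟩
    suc r + B                      ≡⟨ +-comm (suc r) B ⟩
    B + suc r                      ≤⟨ +-monoʳ-≤ B (m≤m+n (suc r) (interiorSize post)) ⟩
    B + interiorSize (suc (suc r) ∷ post) ≡⟨ interiorSize-++ pre (suc (suc r) ∷ post) ⟨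
    interiorSize L                 ∎)
    where open ≤-Reasoning

  first-centre : Linked L (suc B) 0
  first-centre = inj₂ (petalEdge⇒daisyEdge pre (suc (suc r)) post (here refl))

  last-centre : Linked L (suc r + B) 0
  last-centre = inj₁ (subst (λ z → (z , 0) ∈ˡ daisyEdges 0 L) (+-comm B (suc r))
                        (petalEdge⇒daisyEdge pre (suc (suc r)) post (there (here refl))))

  consecutive : ∀ {i} → i < r → Linked L (suc i + B) (suc (suc i) + B)
  consecutive {i} i<r = inj₁ (subst (λ z → (z , suc z) ∈ˡ daisyEdges 0 L) (+-suc i B)
                         (petalEdge⇒daisyEdge pre (suc (suc r)) post
                           (there (there (∈-pathFrom⁺ (suc B) r i i<r)))))

  inner-≁-centre : All (3 ≤_) L → ∀ {j} → 2 ≤ j → j ≤ r → ¬ Linked L (j + B) 0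
  inner-≁-centre 3≤L {j} 2≤j j≤r =
    interior-≁-centre pre (suc (suc r)) post 3≤L (+-monoˡ-≤ B 2≤j)
      (subst (j + B <_) (+-comm (suc r) B) (+-monoˡ-≤ B (s≤s j≤r)))

-- The dominating set

-- d is the distance from the last vertex of the petal.
picked : ℕ → Bool
picked 0 = false
picked 1 = false
picked 2 = false
picked 3 = true
picked 4 = true
picked (suc (suc (suc (suc (suc d))))) = picked d

tailPattern : (k : ℕ) → Vec Bool k
tailPattern zero    = []
tailPattern (suc k) = picked k ∷ tailPattern k

-- In a petal of length 4 the middle vertex would otherwise see only the centre at distance 2.
headPicked : ℕ → Bool
headPicked (suc (suc r)) = picked r ∨ (r ≡ᵇ 2)
headPicked _             = false

petalSet : Bool → (m : ℕ) → Vec Bool (m ∸ 1)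
petalSet force (suc (suc r)) = (force ∨ headPicked (suc (suc r))) ∷ tailPattern r
petalSet force zero          = []
petalSet force (suc zero)    = []

petalsSet : Bool → (L : List ℕ) → Vec Bool (interiorSize L)
petalsSet force []       = []
petalsSet force (m ∷ ms) = petalSet force m ++ᵥ petalsSet false ms

-- The force flag gives the centre a neighbour in the set.
daisySet : (L : List ℕ) → Subset (daisyOrder L)
daisySet L = inside ∷ petalsSet (not (any headPicked L)) L

tailPattern-‼ : ∀ k {i} → i < k → tailPattern k ‼ i ≡ picked (k ∸ suc i)
tailPattern-‼ (suc k) {zero}  _         = refl
tailPattern-‼ (suc k) {suc i} (s≤s i<k) = tailPattern-‼ k i<k

firstOnly : Bool → List ℕ → Bool
firstOnly force []      = force
firstOnly force (_ ∷ _) = false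

petalsSet-‼ : ∀ force pre m post {i} → i < m ∸ 1 →
              petalsSet force (pre ++ m ∷ post) ‼ (interiorSize pre + i) ≡ petalSet (firstOnly force pre) m ‼ i
petalsSet-‼ force []        m post i<m = ‼-++ˡ (petalSet force m) (petalsSet false post) i<m
petalsSet-‼ force (q ∷ pre) m post {i} i<m = begin
  petalsSet force (q ∷ pre ++ m ∷ post) ‼ (interiorSize (q ∷ pre) + i)
    ≡⟨ cong (petalsSet force (q ∷ pre ++ m ∷ post) ‼_) (+-assoc (q ∸ 1) (interiorSize pre) i) ⟩
  petalsSet force (q ∷ pre ++ m ∷ post) ‼ ((q ∸ 1) + (interiorSize pre + i))
    ≡⟨ ‼-++ʳ (petalSet force q) (petalsSet false (pre ++ m ∷ post)) _ ⟩
  petalsSet false (pre ++ m ∷ post) ‼ (interiorSize pre + i)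
    ≡⟨ petalsSet-‼ false pre m post i<m ⟩
  petalSet (firstOnly false pre) m ‼ i
    ≡⟨ cong (λ b → petalSet b m ‼ i) (firstOnly-false pre) ⟩
  petalSet false m ‼ i ∎
  where
  open ≡-Reasoning
  firstOnly-false : ∀ pre → firstOnly false pre ≡ false
  firstOnly-false []      = refl
  firstOnly-false (_ ∷ _) = refl

daisySet-‼ : ∀ pre m post {i} → i < m ∸ 1 →
             daisySet (pre ++ m ∷ post) ‼ (suc i + interiorSize pre)
               ≡ petalSet (firstOnly (not (any headPicked (pre ++ m ∷ post))) pre) m ‼ i
daisySet-‼ pre m post {i} i<m =
  trans (cong (petalsSet force (pre ++ m ∷ post) ‼_) (+-comm i (interiorSize pre)))
        (petalsSet-‼ force pre m post i<m)
  where
  force : Bool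
  force = not (any headPicked (pre ++ m ∷ post))

petalSet-picked : ∀ force r {i} → i ≤ r → picked (r ∸ i) ≡ true → petalSet force (suc (suc r)) ‼ i ≡ true
petalSet-picked force r {zero}  _   pr = trans (cong (λ b → force ∨ (b ∨ (r ≡ᵇ 2))) pr) (∨-zeroʳ force)
petalSet-picked force r {suc i} i<r pr = trans (tailPattern-‼ r i<r) pr

petalSet-head : ∀ force r → (headPicked (suc (suc r)) ≡ true) ⊎ (force ≡ true) →
                petalSet force (suc (suc r)) ‼ 0 ≡ true
petalSet-head force r (inj₁ hp)   = trans (cong (force ∨_) hp) (∨-zeroʳ force)
petalSet-head force r (inj₂ refl) = refl

-- Why a petal vertex at distance d ≥ 1 from the last vertex is dominated: by a picked neighbour
-- on either side, or by picked vertices two steps away on both sides (for d = 1 the one beyond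
-- the last vertex is the centre).
data Covered : ℕ → Set where
  previous   : ∀ {d} → picked (suc d) ≡ true → Covered d
  next       : ∀ {d} → picked d ≡ true → Covered (suc d)
  beforeLast : Covered 1
  around     : ∀ {e} → picked (4 + e) ≡ true → picked e ≡ true → Covered (2 + e)

covered : ∀ k → Covered (suc k)
covered 0 = beforeLast
covered 1 = previous refl
covered 2 = previous refl
covered 3 = next refl
covered 4 = next refl
covered 5 = around refl refl
covered (suc (suc (suc (suc (suc (suc k)))))) = shift (covered (suc k))
  where
  shift : Covered (2 + k) → Covered (7 + k)
  shift (previous p)   = previous p
  shift (next p)       = next p
  shift (around p₄ p₀) = around p₄ p₀

Linked-+2 : ∀ L x → ¬ Linked L (suc x) (3 + x)
Linked-+2 L x (inj₁ e) with daisyEdge-shape 0 L e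
... | inj₂ (inj₂ 3+x≡2+x) = 1+n≢n (suc-injective (suc-injective 3+x≡2+x))
Linked-+2 L x (inj₂ e) with daisyEdge-shape 0 L e
... | inj₂ (inj₂ 1+x≡4+x) = <⇒≢ (m<n+m (suc x) {3} (s≤s z≤n)) 1+x≡4+x

offset-≤ : ∀ a b {j d} → {True (a ≤? b)} → a + j ≤ b + j + d
offset-≤ a b {j} {d} {a≤b} = ≤-trans (+-monoˡ-≤ j (toWitness a≤b)) (m≤m+n (b + j) d)

module PetalDomination (pre : List ℕ) (r : ℕ) (post : List ℕ)
                       (3≤L : All (3 ≤_) (pre ++ suc (suc r) ∷ post)) where

  open Petal pre r post
  open Labelled (Linked L) (daisySet L)

  force : Bool
  force = firstOnly (not (any headPicked L)) pre

  picked∈ : ∀ {j d} → 1 ≤ j → j + d ≡ suc r → picked d ≡ true → daisySet L ‼ (j + B) ≡ true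
  picked∈ {suc i} {d} _ i+d≡r pd =
    trans (daisySet-‼ pre (suc (suc r)) post i<1+r)
          (petalSet-picked force r (≤-pred i<1+r) (trans (cong picked r∸i≡d) pd))
    where
    i+d≡r′ : i + d ≡ r
    i+d≡r′ = suc-injective i+d≡r
    i<1+r : i < suc r
    i<1+r = s≤s (subst (i ≤_) i+d≡r′ (m≤m+n i d))
    r∸i≡d : r ∸ i ≡ d
    r∸i≡d = trans (cong (_∸ i) (sym i+d≡r′)) (m+n∸m≡n i d)

  head∈ : (headPicked (suc (suc r)) ≡ true) ⊎ (force ≡ true) → daisySet L ‼ (1 + B) ≡ true
  head∈ h = trans (daisySet-‼ pre (suc (suc r)) post (s≤s z≤n)) (petalSet-head force r h)

  second-centre : 2 ≤ r → AtDistance2 (2 + B) 0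
  second-centre 2≤r =
    (λ ()) , inner-≁-centre 3≤L ≤-refl 2≤r ,
    1 + B , vertex<order (s≤s z≤n) , Linked-sym {L} (consecutive (≤-trans (s≤s z≤n) 2≤r)) , first-centre

  penultimate-centre : ∀ {i} → 2 + i ≡ r → AtDistance2 (2 + i + B) 0
  penultimate-centre {i} 2+i≡r =
    (λ ()) , inner-≁-centre 3≤L (s≤s (s≤s z≤n)) (≤-reflexive 2+i≡r) ,
    3 + i + B , vertex<order (s≤s (≤-reflexive 2+i≡r)) , consecutive (≤-reflexive 2+i≡r) ,
    subst (λ z → Linked L (suc z + B) 0) (sym 2+i≡r) last-centre

  two-apart : ∀ {i} → 2 + i ≤ r → AtDistance2 (1 + i + B) (3 + i + B)
  two-apart {i} 2+i≤r =
    <⇒≢ (n≤1+n (2 + i + B)) , Linked-+2 L (i + B) ,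
    2 + i + B , vertex<order (≤-trans 2+i≤r (n≤1+n r)) ,
    consecutive (≤-trans (n≤1+n _) 2+i≤r) , consecutive 2+i≤r

  AtDistance2-sym : ∀ {x y} → AtDistance2 x y → AtDistance2 y x
  AtDistance2-sym (x≢y , ¬xy , z , z< , xz , zy) =
    (λ y≡x → x≢y (sym y≡x)) , (λ yx → ¬xy (Linked-sym {L} yx)) , z , z< , Linked-sym {L} zy , Linked-sym {L} xz

  -- Vertex 2 + j lies at distance d + 1 from the last vertex r + 1.
  inner-dominated : ∀ j d → r ≡ 2 + j + d → Covered (suc d) → Dominated (2 + j + B)
  inner-dominated j d refl (previous p) =
    inj₁ (1 + j + B , vertex<order (offset-≤ 1 3) , picked∈ (s≤s z≤n) (cong suc (x∙yz≈y∙xz j 2 d)) p ,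
          Linked-sym {L} (consecutive (offset-≤ 1 2)))
  inner-dominated j d refl (next p) =
    inj₁ (3 + j + B , vertex<order (offset-≤ 3 3) , picked∈ (s≤s z≤n) refl p , consecutive (offset-≤ 2 2))
  inner-dominated zero zero refl beforeLast =
    inj₁ (1 + B , vertex<order (s≤s z≤n) , head∈ (inj₁ refl) , Linked-sym {L} (consecutive (s≤s z≤n)))
  inner-dominated (suc j) zero refl beforeLast =
    inj₂ (1 + j + B , 0 , (λ ()) , vertex<order (offset-≤ 1 4) , s≤s z≤n ,
          picked∈ (s≤s z≤n) (cong suc (x∙yz≈y∙xz j 3 0)) refl , refl ,
          AtDistance2-sym (two-apart (offset-≤ 2 3)) , penultimate-centre (cong (3 +_) (sym (+-identityʳ j))))
  inner-dominated zero (suc e) refl (around p₄ p₀) =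
    inj₂ (0 , 4 + B , (λ ()) , s≤s z≤n , vertex<order (offset-≤ 4 4) , refl , picked∈ (s≤s z≤n) refl p₀ ,
          second-centre (offset-≤ 2 2) , two-apart (offset-≤ 3 3))
  inner-dominated (suc j) (suc e) refl (around p₄ p₀) =
    inj₂ (1 + j + B , 5 + j + B , <⇒≢ (s≤s (s≤s (m≤n+m (j + B) 3))) ,
          vertex<order (offset-≤ 1 4) , vertex<order (subst (5 + j ≤_) shift (offset-≤ 5 5)) ,
          picked∈ (s≤s z≤n) (trans (cong suc (x∙yz≈y∙xz j 4 e)) shift) p₄ , picked∈ (s≤s z≤n) shift p₀ ,
          AtDistance2-sym (two-apart (offset-≤ 2 3)) ,
          two-apart (subst (4 + j ≤_) (suc-injective shift) (offset-≤ 4 4)))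
    where
    shift : 5 + (j + e) ≡ 4 + (j + suc e)
    shift = cong (4 +_) (sym (+-suc j e))

  petalVertex-dominated : ∀ {j} → 1 ≤ j → j ≤ suc r → Dominated (j + B)
  petalVertex-dominated {suc zero}    _ _       = inj₁ (0 , s≤s z≤n , refl , first-centre)
  petalVertex-dominated {suc (suc j)} _ 2+j≤1+r with m≤n⇒m<n∨m≡n (≤-pred 2+j≤1+r)
  ... | inj₂ 1+j≡r  = inj₁ (0 , s≤s z≤n , refl , subst (λ z → Linked L (suc z + B) 0) (sym 1+j≡r) last-centre)
  ... | inj₁ 2+j≤r = inner-dominated j (r ∸ (2 + j)) (sym (m+[n∸m]≡n 2+j≤r)) (covered (r ∸ (2 + j)))

  centre-dominated : (headPicked (suc (suc r)) ≡ true) ⊎ (force ≡ true) → Dominated 0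
  centre-dominated h = inj₁ (1 + B , vertex<order (s≤s z≤n) , head∈ h , Linked-sym {L} first-centre)

headPicked-split : ∀ L → any headPicked L ≡ true →
                   ∃[ pre ] ∃[ r ] ∃[ post ] (L ≡ pre ++ suc (suc r) ∷ post × headPicked (suc (suc r)) ≡ true)
headPicked-split L hp with find (any⁻ headPicked L (Equivalence.from T-≡ hp))
... | suc (suc r) , m∈L , T-hp with ∈-∃++ m∈L
...   | pre , post , refl = pre , r , post , refl , Equivalence.to T-≡ T-hp

centreCoveringPetal : ∀ L → 1 ≤ length L → All (3 ≤_) L →
                      ∃[ pre ] ∃[ r ] ∃[ post ] (L ≡ pre ++ suc (suc r) ∷ post
                        × ((headPicked (suc (suc r)) ≡ true) ⊎ (firstOnly (not (any headPicked L)) pre ≡ true)))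
centreCoveringPetal L _ _ with any headPicked L in hp
... | true with headPicked-split L hp
...   | pre , r , post , L≡ , hpm = pre , r , post , L≡ , inj₁ hpm
centreCoveringPetal (suc (suc r) ∷ ms) _ (s≤s (s≤s _) ∷ _) | false = [] , r , ms , refl , inj₂ refl

daisySet-dominates : ∀ L → 1 ≤ length L → All (3 ≤_) L →
                     ∀ x → x < daisyOrder L → Labelled.Dominated (Linked L) (daisySet L) x
daisySet-dominates L 1≤∣L∣ 3≤L zero _ with centreCoveringPetal L 1≤∣L∣ 3≤L
... | pre , r , post , refl , h = PetalDomination.centre-dominated pre r post 3≤L h
daisySet-dominates L 1≤∣L∣ 3≤L (suc x) x< with locate 0 L (suc x) (s≤s z≤n) (≤-pred x<)
... | petalPosition pre m post j refl x≡ 1≤j j≤ with ++⁻ʳ pre 3≤L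
...   | s≤s (s≤s {n = r} _) ∷ _ =
  subst (Labelled.Dominated (Linked L) (daisySet L)) (sym x≡)
        (PetalDomination.petalVertex-dominated pre r post 3≤L 1≤j j≤)

daisySet-isDTD : ∀ L → 1 ≤ length L → All (3 ≤_) L → IsDTD (DaisyAdj L) (daisySet L)
daisySet-isDTD L 1≤∣L∣ 3≤L = Labelled.isDTD (Linked L) (daisySet L) (daisySet-dominates L 1≤∣L∣ 3≤L)

-- Size of the dominating set

slack-cancel : ∀ {a s c t} → a + s ≡ c + t → c ≤ s → a ≤ t
slack-cancel {a} {s} {c} {t} a+s≡c+t c≤s = +-cancelˡ-≤ c a t (begin
  c + a ≡⟨ +-comm c a ⟩
  a + c ≤⟨ +-monoʳ-≤ a c≤s ⟩
  a + s ≡⟨ a+s≡c+t ⟩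
  c + t ∎)
  where open ≤-Reasoning

∣∣-++ : ∀ {k l} (xs : Subset k) (ys : Subset l) → ∣ xs ++ᵥ ys ∣ ≡ ∣ xs ∣ + ∣ ys ∣
∣∣-++ []           ys = refl
∣∣-++ (true ∷ xs)  ys = cong suc (∣∣-++ xs ys)
∣∣-++ (false ∷ xs) ys = ∣∣-++ xs ys

pickedWindow : ∀ k {n} (v : Vec Bool n) →
  ∣ picked (4 + k) ∷ picked (3 + k) ∷ picked (2 + k) ∷ picked (1 + k) ∷ picked k ∷ v ∣ ≡ 2 + ∣ v ∣
pickedWindow 0 v = refl
pickedWindow 1 v = refl
pickedWindow 2 v = refl
pickedWindow 3 v = refl
pickedWindow 4 v = refl
pickedWindow (suc (suc (suc (suc (suc k))))) v = pickedWindow k v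

patternSlack : ℕ → ℕ
patternSlack 0 = 0
patternSlack 1 = 1
patternSlack 2 = 2
patternSlack 3 = 3
patternSlack 4 = 2
patternSlack (suc (suc (suc (suc (suc k))))) = suc (patternSlack k)

tailPattern-count : ∀ k → 2 * ∣ tailPattern k ∣ + patternSlack k ≡ k
tailPattern-count 0 = refl
tailPattern-count 1 = refl
tailPattern-count 2 = refl
tailPattern-count 3 = refl
tailPattern-count 4 = refl
tailPattern-count (suc (suc (suc (suc (suc k))))) = begin
  2 * ∣ tailPattern (5 + k) ∣ + suc (patternSlack k)
    ≡⟨ cong (λ c → 2 * c + suc (patternSlack k)) (pickedWindow k (tailPattern k)) ⟩
  2 * (2 + ∣ tailPattern k ∣) + suc (patternSlack k)
    ≡⟨ arith ∣ tailPattern k ∣ (patternSlack k) ⟩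
  5 + (2 * ∣ tailPattern k ∣ + patternSlack k)
    ≡⟨ cong (5 +_) (tailPattern-count k) ⟩
  5 + k ∎
  where
  open ≡-Reasoning
  arith : ∀ c s → 2 * (2 + c) + suc s ≡ 5 + (2 * c + s)
  arith = solve-∀

patternSlack-pos : ∀ k → 1 ≤ patternSlack (suc k)
patternSlack-pos 0 = s≤s z≤n
patternSlack-pos 1 = s≤s z≤n
patternSlack-pos 2 = s≤s z≤n
patternSlack-pos 3 = s≤s z≤n
patternSlack-pos (suc (suc (suc (suc k)))) = s≤s z≤n

petalSlack : Bool → ℕ → ℕ
petalSlack force (suc (suc r)) =
  if force ∨ headPicked (suc (suc r)) then patternSlack r ∸ 1 else suc (patternSlack r)
petalSlack force _ = 0

petalSet-count : ∀ force r → 1 ≤ r →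
                 2 * ∣ petalSet force (suc (suc r)) ∣ + petalSlack force (suc (suc r)) ≡ suc r
-- patternSlack-pos excludes patternSlack (suc r) = 0, where ∸ 1 would truncate.
petalSet-count force (suc r) _ with force ∨ headPicked (3 + r) | patternSlack-pos r | tailPattern-count (suc r)
... | true  | _ | count with patternSlack (suc r)
...   | suc s = trans (arith ∣ tailPattern (suc r) ∣ s) (cong suc count)
  where
  arith : ∀ c s → 2 * (1 + c) + s ≡ 1 + (2 * c + suc s)
  arith = solve-∀
petalSet-count force (suc r) _ | false | _ | count =
  trans (arith ∣ tailPattern (suc r) ∣ (patternSlack (suc r))) (cong suc count)
  where
  arith : ∀ c s → 2 * c + suc s ≡ 1 + (2 * c + s)
  arith = solve-∀

slack : Bool → List ℕ → ℕ
slack force []       = 0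
slack force (m ∷ ms) = petalSlack force m + slack false ms

petalsSet-count : ∀ force L → All (3 ≤_) L → 2 * ∣ petalsSet force L ∣ + slack force L ≡ interiorSize L
petalsSet-count force [] [] = refl
petalsSet-count force (suc (suc (suc r)) ∷ ms) (s≤s (s≤s (s≤s _)) ∷ 3≤ms) = begin
  2 * ∣ P ++ᵥ Q ∣ + (petalSlack force m + slack false ms)
    ≡⟨ cong (λ c → 2 * c + (petalSlack force m + slack false ms)) (∣∣-++ P Q) ⟩
  2 * (∣ P ∣ + ∣ Q ∣) + (petalSlack force m + slack false ms)
    ≡⟨ arith ∣ P ∣ ∣ Q ∣ (petalSlack force m) (slack false ms) ⟩
  (2 * ∣ P ∣ + petalSlack force m) + (2 * ∣ Q ∣ + slack false ms)
    ≡⟨ cong₂ _+_ (petalSet-count force (suc r) (s≤s z≤n)) (petalsSet-count false ms 3≤ms) ⟩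
  (m ∸ 1) + interiorSize ms ∎
  where
  open ≡-Reasoning
  m : ℕ
  m = suc (suc (suc r))
  P : Subset (m ∸ 1)
  P = petalSet force m
  Q : Subset (interiorSize ms)
  Q = petalsSet false ms
  arith : ∀ a b s t → 2 * (a + b) + (s + t) ≡ (2 * a + s) + (2 * b + t)
  arith = solve-∀

daisySet-count : ∀ L → All (3 ≤_) L →
                 2 * ∣ daisySet L ∣ + slack (not (any headPicked L)) L ≡ 2 + interiorSize L
daisySet-count L 3≤L =
  trans (arith ∣ petalsSet force L ∣ (slack force L)) (cong (2 +_) (petalsSet-count force L 3≤L))
  where
  force : Bool
  force = not (any headPicked L)
  arith : ∀ c s → 2 * (1 + c) + s ≡ 2 + (2 * c + s)
  arith = solve-∀

petalSlack-large : ∀ force k → 2 ≤ petalSlack force (13 + k)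
petalSlack-large force k with force ∨ headPicked (13 + k)
... | true  = s≤s (patternSlack-pos k)
... | false = s≤s (s≤s z≤n)

petalSlack-≥2 : ∀ k → (2 ≤ petalSlack false (3 + k)) ⊎ (3 + k ≡ 4) ⊎ (3 + k ≡ 6)
petalSlack-≥2 0 = inj₁ (s≤s (s≤s z≤n))
petalSlack-≥2 1 = inj₂ (inj₁ refl)
petalSlack-≥2 2 = inj₁ (s≤s (s≤s z≤n))
petalSlack-≥2 3 = inj₂ (inj₂ refl)
petalSlack-≥2 4 = inj₁ (s≤s (s≤s z≤n))
petalSlack-≥2 5 = inj₁ (s≤s (s≤s z≤n))
petalSlack-≥2 6 = inj₁ (s≤s (s≤s z≤n))
petalSlack-≥2 7 = inj₁ (s≤s (s≤s z≤n))
petalSlack-≥2 8 = inj₁ (s≤s (s≤s z≤n))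
petalSlack-≥2 9 = inj₁ (s≤s (s≤s z≤n))
petalSlack-≥2 (suc (suc (suc (suc (suc (suc (suc (suc (suc (suc k)))))))))) = inj₁ (petalSlack-large false k)

petalSlack-≥1 : ∀ k → 1 ≤ petalSlack false (3 + k)
petalSlack-≥1 k with petalSlack-≥2 k
... | inj₁ 2≤s         = ≤-trans (n≤1+n 1) 2≤s
... | inj₂ (inj₁ refl) = s≤s z≤n
... | inj₂ (inj₂ refl) = s≤s z≤n

petalSlack-unforced : ∀ k → headPicked (3 + k) ≡ false → petalSlack false (3 + k) ≡ 2 + petalSlack true (3 + k)
petalSlack-unforced k hp rewrite hp with patternSlack (suc k) | patternSlack-pos k
... | suc s | _ = refl

petalSlack-≥3 : ∀ k → headPicked (3 + k) ≡ false → (3 ≤ petalSlack false (3 + k)) ⊎ (3 + k ≡ 3) ⊎ (3 + k ≡ 7)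
petalSlack-≥3 0 _  = inj₂ (inj₁ refl)
petalSlack-≥3 1 ()
petalSlack-≥3 2 ()
petalSlack-≥3 3 ()
petalSlack-≥3 4 _  = inj₂ (inj₂ refl)
petalSlack-≥3 5 _  = inj₁ (s≤s (s≤s (s≤s z≤n)))
petalSlack-≥3 6 _  = inj₁ (s≤s (s≤s (s≤s z≤n)))
petalSlack-≥3 7 ()
petalSlack-≥3 8 ()
petalSlack-≥3 9 _  = inj₁ (s≤s (s≤s (s≤s z≤n)))
petalSlack-≥3 (suc (suc (suc (suc (suc (suc (suc (suc (suc (suc k)))))))))) hp =
  inj₁ (subst (3 ≤_) (sym (petalSlack-unforced (10 + k) hp))
               (+-monoʳ-≤ 2 (≤-trans (n≤1+n 1) (petalSlack-large true k))))

forcedPetalSlack-≥1 : ∀ k → headPicked (3 + k) ≡ false → (1 ≤ petalSlack true (3 + k)) ⊎ (3 + k ≡ 3) ⊎ (3 + k ≡ 7)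
forcedPetalSlack-≥1 k hp with petalSlack-≥3 k hp
... | inj₁ 3≤s   = inj₁ (+-cancelˡ-≤ 2 1 _ (subst (3 ≤_) (petalSlack-unforced k hp) 3≤s))
... | inj₂ small = inj₂ small

unforcedPetalSlack-≥2 : ∀ k → headPicked (3 + k) ≡ false → 2 ≤ petalSlack false (3 + k)
unforcedPetalSlack-≥2 k hp = subst (2 ≤_) (sym (petalSlack-unforced k hp)) (m≤m+n 2 _)

Extremal : List ℕ → Set
Extremal L = (L ≡ 3 ∷ 3 ∷ []) ⊎ (L ≡ 4 ∷ 4 ∷ []) ⊎ (L ≡ 3 ∷ 7 ∷ []) ⊎ (L ≡ 7 ∷ 3 ∷ [])

-- The other daisies with slack 2; for them daisySet is not optimal.
Borderline : List ℕ → Set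
Borderline L = (L ≡ 4 ∷ 6 ∷ []) ⊎ (L ≡ 6 ∷ 4 ∷ []) ⊎ (L ≡ 6 ∷ 6 ∷ []) ⊎ (L ≡ 7 ∷ 7 ∷ [])

none-headPicked : ∀ L → any headPicked L ≡ false → All (λ m → headPicked m ≡ false) L
none-headPicked []       _  = []
none-headPicked (m ∷ ms) hp = ∨-conicalˡ _ _ hp ∷ none-headPicked ms (∨-conicalʳ _ _ hp)

slack-≥length : ∀ L → All (3 ≤_) L → length L ≤ slack false L
slack-≥length [] [] = z≤n
slack-≥length (suc (suc (suc k)) ∷ ms) (s≤s (s≤s (s≤s _)) ∷ 3≤ms) =
  +-mono-≤ (petalSlack-≥1 k) (slack-≥length ms 3≤ms)

slack-≥2*length : ∀ L → All (3 ≤_) L → All (λ m → headPicked m ≡ false) L → 2 * length L ≤ slack false L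
slack-≥2*length [] [] [] = z≤n
slack-≥2*length (suc (suc (suc k)) ∷ ms) (s≤s (s≤s (s≤s _)) ∷ 3≤ms) (hp ∷ hps) =
  ≤-trans (≤-reflexive (*-distribˡ-+ 2 1 (length ms)))
    (+-mono-≤ (unforcedPetalSlack-≥2 k hp) (slack-≥2*length ms 3≤ms hps))

unforced-slack : ∀ L → 2 ≤ length L → All (3 ≤_) L →
                 2 ≤ slack false L × ((3 ≤ slack false L) ⊎ Extremal L ⊎ Borderline L)
unforced-slack L 2≤∣L∣ 3≤L = ≤-trans 2≤∣L∣ (slack-≥length L 3≤L) , strict L 2≤∣L∣ 3≤L
  where
  strict : ∀ L → 2 ≤ length L → All (3 ≤_) L → (3 ≤ slack false L) ⊎ Extremal L ⊎ Borderline L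
  strict (_ ∷ []) (s≤s ()) _
  strict (_ ∷ _ ∷ _ ∷ _) _ 3≤L = inj₁ (≤-trans (s≤s (s≤s (s≤s z≤n))) (slack-≥length _ 3≤L))
  strict (suc (suc (suc k₁)) ∷ suc (suc (suc k₂)) ∷ []) _ (s≤s (s≤s (s≤s _)) ∷ s≤s (s≤s (s≤s _)) ∷ [])
    with petalSlack-≥2 k₁ | petalSlack-≥2 k₂
  ... | inj₁ 2≤s₁ | _ = inj₁ (+-mono-≤ 2≤s₁ (≤-trans (petalSlack-≥1 k₂) (m≤m+n _ 0)))
  ... | inj₂ _ | inj₁ 2≤s₂ = inj₁ (+-mono-≤ (petalSlack-≥1 k₁) (≤-trans 2≤s₂ (m≤m+n _ 0)))
  ... | inj₂ (inj₁ refl) | inj₂ (inj₁ refl) = inj₂ (inj₁ (inj₂ (inj₁ refl)))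
  ... | inj₂ (inj₁ refl) | inj₂ (inj₂ refl) = inj₂ (inj₂ (inj₁ refl))
  ... | inj₂ (inj₂ refl) | inj₂ (inj₁ refl) = inj₂ (inj₂ (inj₂ (inj₁ refl)))
  ... | inj₂ (inj₂ refl) | inj₂ (inj₂ refl) = inj₂ (inj₂ (inj₂ (inj₂ (inj₁ refl))))

forced-slack : ∀ L → 2 ≤ length L → All (3 ≤_) L → All (λ m → headPicked m ≡ false) L →
               2 ≤ slack true L × ((3 ≤ slack true L) ⊎ Extremal L ⊎ Borderline L)
forced-slack (suc (suc (suc k₁)) ∷ ms) (s≤s 1≤∣ms∣) (s≤s (s≤s (s≤s _)) ∷ 3≤ms) (hp₁ ∷ hps) =
  ≤-trans (≤-trans (*-monoʳ-≤ 2 1≤∣ms∣) (slack-≥2*length ms 3≤ms hps)) (m≤n+m _ _) , strict ms 1≤∣ms∣ 3≤ms hps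
  where
  strict : ∀ ms → 1 ≤ length ms → All (3 ≤_) ms → All (λ m → headPicked m ≡ false) ms →
           (3 ≤ petalSlack true (3 + k₁) + slack false ms) ⊎ Extremal (3 + k₁ ∷ ms) ⊎ Borderline (3 + k₁ ∷ ms)
  strict (_ ∷ _ ∷ ms) _ 3≤ms hps =
    inj₁ (≤-trans (≤-trans (s≤s (s≤s (s≤s z≤n))) (*-monoʳ-≤ 2 (s≤s (s≤s (z≤n {length ms})))))
                  (≤-trans (slack-≥2*length _ 3≤ms hps) (m≤n+m _ (petalSlack true (3 + k₁)))))
  strict (suc (suc (suc k₂)) ∷ []) _ (s≤s (s≤s (s≤s _)) ∷ []) (hp₂ ∷ [])
    with forcedPetalSlack-≥1 k₁ hp₁ | petalSlack-≥3 k₂ hp₂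
  ... | inj₁ 1≤s₁ | _ = inj₁ (+-mono-≤ 1≤s₁ (≤-trans (unforcedPetalSlack-≥2 k₂ hp₂) (m≤m+n _ 0)))
  ... | inj₂ _ | inj₁ 3≤s₂ = inj₁ (≤-trans (≤-trans 3≤s₂ (m≤m+n _ 0)) (m≤n+m _ (petalSlack true (3 + k₁))))
  ... | inj₂ (inj₁ refl) | inj₂ (inj₁ refl) = inj₂ (inj₁ (inj₁ refl))
  ... | inj₂ (inj₁ refl) | inj₂ (inj₂ refl) = inj₂ (inj₁ (inj₂ (inj₂ (inj₁ refl))))
  ... | inj₂ (inj₂ refl) | inj₂ (inj₁ refl) = inj₂ (inj₁ (inj₂ (inj₂ (inj₂ refl))))
  ... | inj₂ (inj₂ refl) | inj₂ (inj₂ refl) = inj₂ (inj₂ (inj₂ (inj₂ (inj₂ refl))))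

daisySlack-bound : ∀ L → 2 ≤ length L → All (3 ≤_) L →
                   2 ≤ slack (not (any headPicked L)) L
                   × ((3 ≤ slack (not (any headPicked L)) L) ⊎ Extremal L ⊎ Borderline L)
daisySlack-bound L 2≤∣L∣ 3≤L with any headPicked L in hp
... | true  = unforced-slack L 2≤∣L∣ 3≤L
... | false = forced-slack L 2≤∣L∣ 3≤L (none-headPicked L hp)

-- Small daisies

DaisyAdj? : ∀ L u v → Dec (DaisyAdj L u v)
DaisyAdj? L u v = ((toℕ u , toℕ v) ∈ˡ? daisyEdges 0 L) ⊎-dec ((toℕ v , toℕ u) ∈ˡ? daisyEdges 0 L)

↭-pair-inv : ∀ {A : Set} {L : List A} {x y} → L ↭ x ∷ y ∷ [] → (L ≡ x ∷ y ∷ []) ⊎ (L ≡ y ∷ x ∷ [])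
↭-pair-inv {L = a ∷ b ∷ []} p with ∈-resp-↭ p (here refl)
... | here refl         = inj₁ (cong (a ∷_) (↭-singleton-inv (drop-∷ p)))
... | there (here refl) = inj₂ (cong (a ∷_) (↭-singleton-inv (drop-∷ (↭-trans p (↭-swap _ _ ↭-refl)))))
↭-pair-inv {L = []}              p with () ← ↭-length p
↭-pair-inv {L = _ ∷ []}          p with () ← ↭-length p
↭-pair-inv {L = _ ∷ _ ∷ _ ∷ _}  p with () ← ↭-length p

extremal⇒↭ : ∀ {L} → Extremal L → (L ↭ 3 ∷ 3 ∷ []) ⊎ (L ↭ 4 ∷ 4 ∷ []) ⊎ (L ↭ 3 ∷ 7 ∷ [])
extremal⇒↭ (inj₁ refl)                = inj₁ ↭-refl
extremal⇒↭ (inj₂ (inj₁ refl))         = inj₂ (inj₁ ↭-refl)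
extremal⇒↭ (inj₂ (inj₂ (inj₁ refl)))  = inj₂ (inj₂ ↭-refl)
extremal⇒↭ (inj₂ (inj₂ (inj₂ refl)))  = inj₂ (inj₂ (↭-swap 7 3 ↭-refl))

↭⇒extremal : ∀ {L} → (L ↭ 3 ∷ 3 ∷ []) ⊎ (L ↭ 4 ∷ 4 ∷ []) ⊎ (L ↭ 3 ∷ 7 ∷ []) → Extremal L
↭⇒extremal (inj₁ p) with ↭-pair-inv p
... | inj₁ refl = inj₁ refl
... | inj₂ refl = inj₁ refl
↭⇒extremal (inj₂ (inj₁ p)) with ↭-pair-inv p
... | inj₁ refl = inj₂ (inj₁ refl)
... | inj₂ refl = inj₂ (inj₁ refl)
↭⇒extremal (inj₂ (inj₂ p)) with ↭-pair-inv p
... | inj₁ refl = inj₂ (inj₂ (inj₁ refl))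
... | inj₂ refl = inj₂ (inj₂ (inj₂ refl))

dtd-by-computation : ∀ L (S : Subset (daisyOrder L)) → {True (IsDTD? (DaisyAdj? L) S)} → IsDTD (DaisyAdj L) S
dtd-by-computation L S {dtd} = toWitness dtd

noSmallerDTD-by-computation : ∀ L k → {False (anySubset? (λ S → ∣ S ∣ <? k ×-dec IsDTD? (DaisyAdj? L) S))} →
                              ¬ (∃[ S ] (∣ S ∣ < k × IsDTD (DaisyAdj L) S))
noSmallerDTD-by-computation L k {none} = toWitnessFalse none

extremal-γ : ∀ {L m} → Extremal L → IsGammaTD (DaisyAdj L) m → interiorSize L ≤ 2 * m
extremal-γ (inj₁ refl) γ =
  *-monoʳ-≤ 2 (gammaTD-≥ γ (noSmallerDTD-by-computation (3 ∷ 3 ∷ []) 2))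
extremal-γ (inj₂ (inj₁ refl)) γ =
  *-monoʳ-≤ 2 (gammaTD-≥ γ (noSmallerDTD-by-computation (4 ∷ 4 ∷ []) 3))
extremal-γ (inj₂ (inj₂ (inj₁ refl))) γ =
  *-monoʳ-≤ 2 (gammaTD-≥ γ (noSmallerDTD-by-computation (3 ∷ 7 ∷ []) 4))
extremal-γ (inj₂ (inj₂ (inj₂ refl))) γ =
  *-monoʳ-≤ 2 (gammaTD-≥ γ (noSmallerDTD-by-computation (7 ∷ 3 ∷ []) 4))

borderline-γ : ∀ {L m} → Borderline L → IsGammaTD (DaisyAdj L) m → 2 * m < interiorSize L
borderline-γ (inj₁ refl) (_ , least) =
  ≤-<-trans (*-monoʳ-≤ 2 (least S (dtd-by-computation (4 ∷ 6 ∷ []) S))) (n≤1+n _)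
  where
  S : Subset 9
  S = false ∷ true ∷ false ∷ false ∷ true ∷ false ∷ false ∷ false ∷ true ∷ []
borderline-γ (inj₂ (inj₁ refl)) (_ , least) =
  ≤-<-trans (*-monoʳ-≤ 2 (least S (dtd-by-computation (6 ∷ 4 ∷ []) S))) (n≤1+n _)
  where
  S : Subset 9
  S = false ∷ true ∷ false ∷ false ∷ false ∷ true ∷ true ∷ false ∷ false ∷ []
borderline-γ (inj₂ (inj₂ (inj₁ refl))) (_ , least) =
  ≤-<-trans (*-monoʳ-≤ 2 (least S (dtd-by-computation (6 ∷ 6 ∷ []) S))) (n≤1+n _)
  where
  S : Subset 11
  S = false ∷ true ∷ false ∷ false ∷ false ∷ true ∷ true ∷ false ∷ false ∷ false ∷ true ∷ []
borderline-γ (inj₂ (inj₂ (inj₂ refl))) (_ , least) =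
  ≤-<-trans (*-monoʳ-≤ 2 (least S (dtd-by-computation (7 ∷ 7 ∷ []) S))) (n≤1+n _)
  where
  S : Subset 13
  S = true ∷ false ∷ true ∷ true ∷ false ∷ false ∷ false ∷ false ∷ true ∷ true ∷ false ∷ false ∷ false ∷ []

proposition9 : (L : List ℕ) → 2 ≤ length L → All (3 ≤_) L →
    ∃[ m ] (IsGammaTD (DaisyAdj L) m
    × 2 * m ≤ daisyOrder L ∸ 1
    × ((2 * m ≡ daisyOrder L ∸ 1)
    ⇔ ((L ↭ (3 ∷ 3 ∷ [])) ⊎ (L ↭ (4 ∷ 4 ∷ [])) ⊎ (L ↭ (3 ∷ 7 ∷ [])))))
proposition9 L 2≤∣L∣ 3≤L
  with gammaTD-exists (DaisyAdj? L) (daisySet L) (daisySet-isDTD L (≤-trans (s≤s z≤n) 2≤∣L∣) 3≤L)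
... | m , γ , m≤∣S∣ = m , γ , bound , mk⇔ tight⇒extremal (λ p → ≤-antisym bound (extremal-γ (↭⇒extremal p) γ))
  where
  count : 2 * ∣ daisySet L ∣ + slack (not (any headPicked L)) L ≡ 2 + interiorSize L
  count = daisySet-count L 3≤L

  2m≤2∣S∣ : 2 * m ≤ 2 * ∣ daisySet L ∣
  2m≤2∣S∣ = *-monoʳ-≤ 2 m≤∣S∣

  bound : 2 * m ≤ interiorSize L
  bound = ≤-trans 2m≤2∣S∣ (slack-cancel count (proj₁ (daisySlack-bound L 2≤∣L∣ 3≤L)))

  tight⇒extremal : 2 * m ≡ interiorSize L → (L ↭ 3 ∷ 3 ∷ []) ⊎ (L ↭ 4 ∷ 4 ∷ []) ⊎ (L ↭ 3 ∷ 7 ∷ [])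
  tight⇒extremal tight with proj₂ (daisySlack-bound L 2≤∣L∣ 3≤L)
  ... | inj₁ 3≤slack     = ⊥-elim (<-irrefl tight (≤-<-trans 2m≤2∣S∣ (slack-cancel (cong suc count) 3≤slack)))
  ... | inj₂ (inj₁ ext)  = extremal⇒↭ ext
  ... | inj₂ (inj₂ bord) = ⊥-elim (<-irrefl tight (borderline-γ bord γ))
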